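{- Let $\leadsto$ be a relation on a type $A$ which is Noetherian and equipped with a local confluence structure, and let $\mathfrak L$ be the associated map from spans to confluence cycles. Let $Q:\text{(cycles of }\leadsto)\to\mathcal U$ be a type family which is stable under merging and under rotating. If $Q(\gamma)$ holds for every empty cycle $\gamma$ and $Q(\mathfrak L(\kappa))$ holds for every span $\kappa$, then $Q(\alpha)$ holds for every cycle $\alpha$. That is, we have a function $\big(\Pi(\gamma:\text{empty cycles}).Q(\gamma)\big)\to\big(\Pi(\kappa:\text{spans}).Q(\mathfrak L(\kappa))\big)\to\Pi(\alpha:\text{cycles}).Q(\alpha)$. If moreover $A$ is a set, then the first hypothesis can be replaced by $\Pi(a:A).\,Q(\epsilon_a)$, where $\epsilon_a$ is the trivial cycle $\mathsf{nil}$ based at $a$.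
   Context: Homotopy type theory setting; a relation on $A$ is an arbitrary type family $(\leadsto):A\to A\to\mathcal U$. Closures: $\leadsto^*$ is the inductive family with $\mathsf{nil}:a\leadsto^*a$ and $\mathsf{snoc}:(a\leadsto^*b)\to(b\leadsto c)\to(a\leadsto^*c)$; $(a\leadsto^s b):=(a\leadsto b)+(b\leadsto a)$; $\leadsto^{s*}:=(\leadsto^s)^*$. Elements of $a\leadsto^{s*}b$ are chains; they can be concatenated ($\alpha::\beta$) and inverted ($\alpha^{ -1}$: reverse the order of segments and swap the summands). A cycle is an element of $\Sigma(a:A).(a\leadsto^{s*}a)$; it is empty if its length (number of segments) is $0$. Rotating a cycle $\mathsf{rot}$ moves its first segment to the end (so the base point moves to the next vertex). Accessibility: for a relation $<$, $\mathsf{acc}^<:A\to\mathcal U$ is inductively generated by $\mathsf{step}:\Pi(a:A).(\Pi(x:A).(x<a)\to\mathsf{acc}^<(x))\to\mathsf{acc}^<(a)$; $<$ is well-founded if $\Pi a.\mathsf{acc}^<(a)$. The relation $\leadsto$ is Noetherian if its opposite ($b\leadsto^{op}a:=a\leadsto b$) is well-founded. A span is a tuple $(u,v,w,s,t)$ with $s:u\leadsto v$, $t:u\leadsto w$; an extended cospan from $v$ to $w$ is $(x,\alpha,\beta)$ with $\alpha:v\leadsto^*x$, $\beta:w\leadsto^*x$. A local confluence structure is a function assigning to every span $(u,v,w,s,t)$ an extended cospan from $v$ to $w$. The confluence cycle $\mathfrak L(\kappa)$ of a span $\kappa$ is the cycle obtained by concatenating the span (as the chain $s^{ -1}::t$ from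 $v$ to $w$) with the reverse of the assigned extended cospan (the chain $\beta::\alpha^{ -1}$ from $w$ back to $v$), with $\alpha,\beta$ regarded as chains. Merging: for $a,b:A$ and chains $\alpha,\beta,\gamma:a\leadsto^{s*}b$, the cycle $\alpha::\gamma^{ -1}$ is the merge of $\alpha::\beta^{ -1}$ and $\beta::\gamma^{ -1}$. $Q$ is stable under merging if whenever $\gamma$ is the merge of $\alpha$ and $\beta$ and $Q(\alpha)$, $Q(\beta)$ hold, then $Q(\gamma)$ holds; $Q$ is stable under rotating if $Q(\delta)$ implies $Q(\mathsf{rot}(\delta))$. -}

module Defs where

open import Level using (Level)
open import Data.Nat using (ℕ; zero; suc)
open import Data.Unit using (⊤; tt)
open import Data.Product using (Σ; _×_; _,_; proj₁; proj₂)
open import Data.Sum using (_⊎_; inj₁; inj₂; swap)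
open import Relation.Binary.PropositionalEquality using (_≡_)
open import Induction.WellFounded using (WellFounded)

module _ {ℓ : Level} {A : Set ℓ} where

  data Star (R : A → A → Set ℓ) : A → A → Set ℓ where
    nil  : ∀ {a} → Star R a a
    snoc : ∀ {a b c} → Star R a b → R b c → Star R a c

  Sym : (R : A → A → Set ℓ) → A → A → Set ℓ
  Sym R a b = R a b ⊎ R b a

  Chain : (R : A → A → Set ℓ) → A → A → Set ℓ
  Chain R = Star (Sym R)

  module _ {R : A → A → Set ℓ} where

    length : ∀ {a b} → Star R a b → ℕ
    length nil = zero
    length (snoc α _) = suc (length α)

    _++_ : ∀ {a b c} → Star R a b → Star R b c → Star R a c
    α ++ nil = α
    α ++ snoc β t = snoc (α ++ β) t

    -- first segment and remainder of a nonempty (snoc α t)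
    uncons : ∀ {a b c} → Star R a b → R b c → Σ A (λ x → R a x × Star R x c)
    uncons {c = c} nil t = c , t , nil
    uncons (snoc α s) t with uncons α s
    ... | x , s' , ρ = x , s' , snoc ρ t

    splitFirst : ∀ {a b} → Star R a b → ⊤ ⊎ Σ A (λ x → R a x × Star R x b)
    splitFirst nil = inj₁ tt
    splitFirst (snoc α t) = inj₂ (uncons α t)

  module _ {R : A → A → Set ℓ} where

    inv : ∀ {a b} → Chain R a b → Chain R b a
    inv nil = nil
    inv (snoc α s) = snoc nil (swap s) ++ inv α

    toChain : ∀ {a b} → Star R a b → Chain R a b
    toChain nil = nil
    toChain (snoc α s) = snoc (toChain α) (inj₁ s)

  Cycle : (R : A → A → Set ℓ) → Set ℓ
  Cycle R = Σ A (λ a → Chain R a a)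

  module _ {R : A → A → Set ℓ} where

    isEmptyCycle : Cycle R → Set
    isEmptyCycle γ = length (proj₂ γ) ≡ 0

    EmptyCycle : Set ℓ
    EmptyCycle = Σ (Cycle R) isEmptyCycle

    ε : A → Cycle R
    ε a = a , nil

    rot : Cycle R → Cycle R
    rot (a , α) with splitFirst α
    ... | inj₁ _ = a , α
    ... | inj₂ (x , s , ρ) = x , snoc ρ s

  record Span (R : A → A → Set ℓ) : Set ℓ where
    constructor span
    field
      u v w : A
      s : R u v
      t : R u w

  ExtCospan : (R : A → A → Set ℓ) → A → A → Set ℓ
  ExtCospan R v w = Σ A (λ x → Star R v x × Star R w x)

  LocalConfluenceStructure : (R : A → A → Set ℓ) → Set ℓ
  LocalConfluenceStructure R = (κ : Span R) → ExtCospan R (Span.v κ) (Span.w κ)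

  confluenceCycle : {R : A → A → Set ℓ} → LocalConfluenceStructure R → Span R → Cycle R
  confluenceCycle {R} L κ with L κ
  ... | x , α , β =
    Span.v κ , ((snoc (snoc nil (inj₂ (Span.s κ))) (inj₁ (Span.t κ)))
                ++ (toChain β ++ inv (toChain α)))

  Noetherian : (R : A → A → Set ℓ) → Set ℓ
  Noetherian R = WellFounded (λ b a → R a b)

  module _ {R : A → A → Set ℓ} where

    StableUnderMerging : (Cycle R → Set ℓ) → Set ℓ
    StableUnderMerging Q = ∀ {a b} (α β γ : Chain R a b)
      → Q (a , α ++ inv β) → Q (a , β ++ inv γ) → Q (a , α ++ inv γ)

    StableUnderRotating : (Cycle R → Set ℓ) → Set ℓ
    StableUnderRotating Q = ∀ δ → Q δ → Q (rot δ)


isSet : {ℓ : Level} → Set ℓ → Set ℓ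
isSet X = (x y : X) (p q : x ≡ y) → p ≡ q

{-# OPTIONS --safe #-}
-- Induct on cycles, ordered by the multiset extension of the strict reduction order on their
-- multisets of vertices; this is well-founded because the relation is Noetherian.  A nonempty
-- cycle cannot consist of steps in one direction only, so some rotation of it starts with a
-- peak v ← u → w.  Merging with the confluence cycle of this span replaces the peak by the
-- chain v →* x *← w of the chosen cospan, whose vertices all lie below u, so the new cycle is
-- smaller; Q travels back along the merge and the rotation.  If A is a set, an empty cycle,
-- which is nil up to transport along a loop a ≡ a, is ε a.
module Submission where

open import Defs
open import Level using (Level; _⊔_)
open import Function using (flip; _∘_)
open import Data.Empty using (⊥; ⊥-elim)
open import Data.Nat using (suc)
open import Data.Product using (Σ; Σ-syntax; ∃-syntax; _×_; _,_; proj₁; proj₂)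
open import Data.Sum using (_⊎_; inj₁; inj₂; swap)
open import Data.Sum.Properties using (swap-involutive)
open import Data.List as List using (List; []; _∷_)
open import Data.List.Relation.Unary.All using (All; []; _∷_)
import Data.List.Relation.Unary.All.Properties as All
open import Data.List.Relation.Unary.Any using (here; there)
open import Data.List.Membership.Propositional.Properties using (∈-∃++)
open import Data.List.Relation.Binary.Permutation.Propositional
  using (_↭_; ↭-refl; ↭-reflexive; ↭-sym; ↭-trans; ↭-prep; ↭-swap)
open import Data.List.Relation.Binary.Permutation.Propositional.Properties
  using (¬x∷xs↭[]; ∈-resp-↭; shift; drop-∷; ++⁺ˡ; ++-comm)
open import Relation.Binary.Core using (Rel)
open import Relation.Binary.PropositionalEquality
  using (_≡_; refl; sym; trans; cong; cong₂; subst; module ≡-Reasoning)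
open import Relation.Binary.Construct.Closure.Transitive as Plus
  using (TransClosure; _∷_; _∷ʳ_)
import Relation.Binary.Construct.On as On
open import Induction.WellFounded using (WellFounded; Acc; acc; acc⇒asym)

-- One step of the multiset extension of _<_; lists stand for multisets up to _↭_.
module Multiset {a r} {A : Set a} (_<_ : Rel A r) where

  infix 4 _⋖_
  _⋖_ : Rel (List A) (a ⊔ r)
  N ⋖ M = ∃[ u ] ∃[ M₀ ] ∃[ K ] (M ↭ u ∷ M₀ × N ↭ K List.++ M₀ × All (_< u) K)

  acc-resp-↭ : ∀ {M M′} → M ↭ M′ → Acc _⋖_ M → Acc _⋖_ M′
  acc-resp-↭ M↭M′ (acc rs) =
    acc λ (u , M₀ , K , M′↭ , N↭ , K<u) → rs (u , M₀ , K , ↭-trans M↭M′ M′↭ , N↭ , K<u)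

  acc-[] : Acc _⋖_ []
  acc-[] = acc λ (_ , _ , _ , []↭u∷M₀ , _) → ⊥-elim (¬x∷xs↭[] (↭-sym []↭u∷M₀))

  ∷-↭-∷-inv : ∀ {x u M M₀} → x ∷ M ↭ u ∷ M₀ →
              (x ≡ u × M ↭ M₀) ⊎ Σ[ M₁ ∈ List A ] (M ↭ u ∷ M₁ × M₀ ↭ x ∷ M₁)
  ∷-↭-∷-inv {x} {u} p with ∈-resp-↭ (↭-sym p) (here refl)
  ... | here refl = inj₁ (refl , drop-∷ p)
  ... | there u∈M with ∈-∃++ u∈M
  ...   | P , S , refl = inj₂ (P List.++ S , shift u P S , ↭-sym (drop-∷ u∷x∷P++S↭))
    where
      u∷x∷P++S↭ : u ∷ x ∷ P List.++ S ↭ u ∷ _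
      u∷x∷P++S↭ = ↭-trans (↭-swap u x ↭-refl) (↭-trans (↭-prep x (↭-sym (shift u P S))) p)

  private
    module _ {x} (ih : ∀ {y} → y < x → ∀ {M} → Acc _⋖_ M → Acc _⋖_ (y ∷ M)) where

      prepend-below : ∀ {K M} → All (_< x) K → Acc _⋖_ M → Acc _⋖_ (K List.++ M)
      prepend-below [] accM = accM
      prepend-below (k<x ∷ K<x) accM = ih k<x (prepend-below K<x accM)

      acc-∷-step : ∀ {M} → Acc _⋖_ M → Acc _⋖_ (x ∷ M)
      acc-∷-step {M} (acc rs) =
        acc λ (u , M₀ , K , x∷M↭ , N↭ , K<u) → acc-resp-↭ (↭-sym N↭) (replace x∷M↭ K<u)
        where
          replace : ∀ {u M₀ K} → x ∷ M ↭ u ∷ M₀ → All (_< u) K → Acc _⋖_ (K List.++ M₀)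
          replace {u} {K = K} x∷M↭ K<u with ∷-↭-∷-inv x∷M↭
          ... | inj₁ (refl , M↭M₀) = prepend-below K<u (acc-resp-↭ M↭M₀ (acc rs))
          ... | inj₂ (M₁ , M↭u∷M₁ , M₀↭x∷M₁) =
            acc-resp-↭ (↭-sym (↭-trans (++⁺ˡ K M₀↭x∷M₁) (shift x K M₁)))
                       (acc-∷-step (rs (u , M₁ , K , M↭u∷M₁ , ↭-refl , K<u)))

  acc-∷ : ∀ {x} → Acc _<_ x → ∀ {M} → Acc _⋖_ M → Acc _⋖_ (x ∷ M)
  acc-∷ (acc rs) = acc-∷-step (λ y<x → acc-∷ (rs y<x))

  wellFounded : WellFounded _<_ → WellFounded _⋖_
  wellFounded wf [] = acc-[]
  wellFounded wf (x ∷ M) = acc-∷ (wf x) (wellFounded wf M)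

module _ {ℓ : Level} {A : Set ℓ} {S : A → A → Set ℓ} where

  private variable
    a b c : A

  [_] : S a b → Star S a b
  [ s ] = snoc nil s

  ++-identityˡ : (γ : Star S a b) → nil ++ γ ≡ γ
  ++-identityˡ nil = refl
  ++-identityˡ (snoc γ s) = cong (λ δ → snoc δ s) (++-identityˡ γ)

  ++-assoc : ∀ {d} (α : Star S a b) (β : Star S b c) (γ : Star S c d) →
             (α ++ β) ++ γ ≡ α ++ (β ++ γ)
  ++-assoc α β nil = refl
  ++-assoc α β (snoc γ s) = cong (λ δ → snoc δ s) (++-assoc α β γ)

  reverse : Star S a b → Star (flip S) b a
  reverse nil = nil
  reverse (snoc γ s) = snoc nil s ++ reverse γ

  data ConsView : Star S a b → Set ℓ where
    nilᵛ  : ConsView (nil {a = a})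
    consᵛ : (s : S a b) (γ : Star S b c) → ConsView γ → ConsView ([ s ] ++ γ)

  consView : (γ : Star S a b) → ConsView γ
  consView nil = nilᵛ
  consView (snoc {b = b} γ s) = snocᵛ (consView γ)
    where
      snocᵛ : ∀ {a} {δ : Star S a b} → ConsView δ → ConsView (snoc δ s)
      snocᵛ nilᵛ = consᵛ s nil nilᵛ
      snocᵛ (consᵛ z δ v) = consᵛ z (snoc δ s) (snocᵛ v)

  uncons-[]++ : ∀ {d} (s : S a b) (γ : Star S b c) (t : S c d) →
                uncons ([ s ] ++ γ) t ≡ (b , s , snoc γ t)
  uncons-[]++ s nil t = refl
  uncons-[]++ s (snoc γ t′) t rewrite uncons-[]++ s γ t′ = refl

  verts : Star S a b → List A
  verts nil = []
  verts (snoc {c = c} γ s) = c ∷ verts γ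

  verts-++ : (α : Star S a b) (β : Star S b c) → verts (α ++ β) ≡ verts β List.++ verts α
  verts-++ α nil = refl
  verts-++ α (snoc {c = c} β s) = cong (c ∷_) (verts-++ α β)

  verts-++-↭ : (α : Star S a b) (β : Star S b c) → verts (α ++ β) ↭ verts α List.++ verts β
  verts-++-↭ α β = ↭-trans (↭-reflexive (verts-++ α β)) (++-comm (verts β) (verts α))

  All-verts-last : ∀ {p} {P : A → Set p} (γ : Star S a b) → P a → All P (verts γ) → P b
  All-verts-last nil Pa [] = Pa
  All-verts-last (snoc γ s) Pa (Pb ∷ _) = Pb

  snoc⁺ : Star S a b → S b c → TransClosure S a c
  snoc⁺ nil s = Plus.[ s ]
  snoc⁺ (snoc γ s′) s = snoc⁺ γ s′ ∷ʳ s

  length≡0⇒nil : (γ : Star S a b) → length γ ≡ 0 → Σ (a ≡ b) λ p → subst (Star S a) p nil ≡ γ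
  length≡0⇒nil nil _ = refl , refl

  module _ (wf : WellFounded S) where

    acyclic : Star S a b → S b a → ⊥
    acyclic γ s = acc⇒asym (Plus.wellFounded S wf _) (snoc⁺ γ s) (snoc⁺ γ s)

    -- The endpoints are related by an equation rather than identified, since matching a
    -- closed path against nil would need K.
    closedPath-length≡0 : (γ : Star S a b) → a ≡ b → length γ ≡ 0
    closedPath-length≡0 nil _ = refl
    closedPath-length≡0 (snoc γ s) refl = ⊥-elim (acyclic γ s)

module _ {ℓ : Level} {A : Set ℓ} {R : A → A → Set ℓ} where

  private variable
    a b c m u v w : A

  rot-[]++ : (s : Sym R a b) (γ : Chain R b a) → rot (a , [ s ] ++ γ) ≡ (b , γ ++ [ s ])
  rot-[]++ s nil = refl
  rot-[]++ s (snoc γ t) rewrite uncons-[]++ s γ t = refl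

  inv-++ : (α : Chain R a b) (β : Chain R b c) → inv (α ++ β) ≡ inv β ++ inv α
  inv-++ α nil = sym (++-identityˡ (inv α))
  inv-++ α (snoc β s) = begin
    [ swap s ] ++ inv (α ++ β)      ≡⟨ cong ([ swap s ] ++_) (inv-++ α β) ⟩
    [ swap s ] ++ (inv β ++ inv α)  ≡⟨ ++-assoc [ swap s ] (inv β) (inv α) ⟨
    ([ swap s ] ++ inv β) ++ inv α  ∎
    where open ≡-Reasoning

  inv-involutive : (γ : Chain R a b) → inv (inv γ) ≡ γ
  inv-involutive nil = refl
  inv-involutive (snoc γ s) = begin
    inv ([ swap s ] ++ inv γ)         ≡⟨ inv-++ [ swap s ] (inv γ) ⟩
    inv (inv γ) ++ [ swap (swap s) ]  ≡⟨ cong₂ snoc (inv-involutive γ) (swap-involutive s) ⟩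
    snoc γ s                          ∎
    where open ≡-Reasoning

  toChain-++ : (α : Star R a b) (β : Star R b c) → toChain (α ++ β) ≡ toChain α ++ toChain β
  toChain-++ α nil = refl
  toChain-++ α (snoc β s) = cong (λ δ → snoc δ (inj₁ s)) (toChain-++ α β)

  verts-toChain : (γ : Star R a b) → verts (toChain γ) ≡ verts γ
  verts-toChain nil = refl
  verts-toChain (snoc {c = c} γ s) = cong (c ∷_) (verts-toChain γ)

  All-verts-inv : ∀ {p} {P : A → Set p} (γ : Chain R a b) →
                  P a → All P (verts γ) → All P (verts (inv γ))
  All-verts-inv nil Pa [] = []
  All-verts-inv (snoc γ s) Pa (_ ∷ Pγ) =
    subst (All _) (sym (verts-++ [ swap s ] (inv γ)))
          (All.++⁺ (All-verts-inv γ Pa Pγ) (All-verts-last γ Pa Pγ ∷ []))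

  toChainᵒᵖ : Star (flip R) a b → Chain R a b
  toChainᵒᵖ nil = nil
  toChainᵒᵖ (snoc γ s) = snoc (toChainᵒᵖ γ) (inj₂ s)

  length-toChainᵒᵖ : (γ : Star (flip R) a b) → length (toChainᵒᵖ γ) ≡ length γ
  length-toChainᵒᵖ nil = refl
  length-toChainᵒᵖ (snoc γ s) = cong suc (length-toChainᵒᵖ γ)

  spanChain : R u v → R u w → Chain R v w
  spanChain s t = snoc (snoc nil (inj₂ s)) (inj₁ t)

  data PeakOrValley (γ : Chain R a b) : Set ℓ where
    peak   : (α : Chain R a v) (s : R u v) (t : R u w) (β : Chain R w b) →
             γ ≡ α ++ (spanChain s t ++ β) → PeakOrValley γ
    valley : (α : Star R a m) (β : Star (flip R) m b) →
             γ ≡ toChain α ++ toChainᵒᵖ β → PeakOrValley γ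

  peakOrValley : (γ : Chain R a b) → PeakOrValley γ
  peakOrValley nil = valley nil nil refl
  peakOrValley (snoc γ z) with peakOrValley γ | z
  ... | peak α s t β eq        | z      = peak α s t (snoc β z) (cong (λ δ → snoc δ z) eq)
  ... | valley α β eq          | inj₂ r = valley α (snoc β r) (cong (λ δ → snoc δ (inj₂ r)) eq)
  ... | valley α nil eq        | inj₁ r = valley (snoc α r) nil (cong (λ δ → snoc δ (inj₁ r)) eq)
  ... | valley α (snoc β s) eq | inj₁ t =
    peak (toChain α ++ toChainᵒᵖ β) s t nil (cong (λ δ → snoc δ (inj₁ t)) eq)

  data CycleShape (γ : Chain R a a) : Set ℓ where
    empty       : length γ ≡ 0 → CycleShape γ
    rotatedPeak : (α : Chain R a v) (β : Chain R v a)
                  (s : R u v) (t : R u w) (δ : Chain R w v) →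
                  γ ≡ α ++ β → β ++ α ≡ spanChain s t ++ δ → CycleShape γ

  cycleShape : Noetherian R → (γ : Chain R a a) → CycleShape γ
  cycleShape noeth γ with peakOrValley γ
  ... | peak α s t β eq = rotatedPeak α (spanChain s t ++ β) s t (β ++ α) eq (++-assoc _ β α)
  ... | valley α β eq with consView α
  ...   | nilᵛ = empty (begin
            length γ                       ≡⟨ cong length (trans eq (++-identityˡ _)) ⟩
            length (toChainᵒᵖ β)           ≡⟨ length-toChainᵒᵖ β ⟩
            length β                       ≡⟨ closedPath-length≡0 noeth β refl ⟩
            0                              ∎)
    where open ≡-Reasoning
  ...   | consᵛ t α′ _ with β
  ...     | nil = ⊥-elim (acyclic noeth (reverse α′) t)
  ...     | snoc β′ s = rotatedPeak (toChain ([ t ] ++ α′) ++ toChainᵒᵖ β′) [ inj₂ s ] s t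
                          (toChain α′ ++ toChainᵒᵖ β′) eq (begin
            [ inj₂ s ] ++ (toChain ([ t ] ++ α′) ++ toChainᵒᵖ β′)
              ≡⟨ cong (λ δ → [ inj₂ s ] ++ (δ ++ toChainᵒᵖ β′)) (toChain-++ [ t ] α′) ⟩
            [ inj₂ s ] ++ (([ inj₁ t ] ++ toChain α′) ++ toChainᵒᵖ β′)
              ≡⟨ cong ([ inj₂ s ] ++_) (++-assoc [ inj₁ t ] (toChain α′) (toChainᵒᵖ β′)) ⟩
            [ inj₂ s ] ++ ([ inj₁ t ] ++ (toChain α′ ++ toChainᵒᵖ β′))
              ≡⟨ ++-assoc [ inj₂ s ] [ inj₁ t ] (toChain α′ ++ toChainᵒᵖ β′) ⟨
            spanChain s t ++ (toChain α′ ++ toChainᵒᵖ β′) ∎)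
    where open ≡-Reasoning

  substᶜ : (Q : Cycle R → Set ℓ) {γ δ : Chain R a a} → γ ≡ δ → Q (a , γ) → Q (a , δ)
  substᶜ Q = subst (λ δ → Q (_ , δ))

  rotate-prefix : {Q : Cycle R → Set ℓ} → StableUnderRotating Q →
                  (α : Chain R a v) (β : Chain R v a) → ConsView β →
                  Q (v , β ++ α) → Q (a , α ++ β)
  rotate-prefix {Q = Q} rotQ α _ nilᵛ q = substᶜ Q (++-identityˡ α) q
  rotate-prefix {Q = Q} rotQ α _ (consᵛ s β β-view) q =
    substᶜ Q (++-assoc α [ s ] β) (rotate-prefix rotQ (α ++ [ s ]) β β-view
      (substᶜ Q (++-assoc β α [ s ]) (subst Q (rot-[]++ s (β ++ α))
        (rotQ _ (substᶜ Q (++-assoc [ s ] β α) q)))))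

  verts-rotate : (α : Chain R a b) (β : Chain R b a) → verts (α ++ β) ↭ verts (β ++ α)
  verts-rotate α β = ↭-trans (↭-reflexive (verts-++ α β)) (↭-sym (verts-++-↭ β α))

  _≺_ : Rel A ℓ
  _≺_ = TransClosure (flip R)

  All-verts-≺ : v ≺ u → (γ : Star R v w) → All (_≺ u) (verts γ)
  All-verts-≺ v≺u nil = []
  All-verts-≺ v≺u (snoc γ s) = (s ∷ All-verts-last γ v≺u γ≺u) ∷ γ≺u
    where γ≺u = All-verts-≺ v≺u γ

  open Multiset _≺_ using (_⋖_)

  _⋖⁺_ : Rel (List A) ℓ
  _⋖⁺_ = TransClosure _⋖_

  _⊏_ : Rel (Cycle R) ℓ
  α ⊏ β = verts (proj₂ α) ⋖⁺ verts (proj₂ β)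

  ⊏-wellFounded : Noetherian R → WellFounded _⊏_
  ⊏-wellFounded noeth =
    On.wellFounded (verts ∘ proj₂)
      (Plus.wellFounded _⋖_ (Multiset.wellFounded _≺_ (Plus.wellFounded (flip R) noeth)))

  module Confluence (L : LocalConfluenceStructure R) where

    cospanChain : R u v → R u w → Chain R v w
    cospanChain s t = let (_ , α , β) = L (span _ _ _ s t) in toChain α ++ inv (toChain β)

    confluenceCycle≡ : (s : R u v) (t : R u w) →
      confluenceCycle L (span u v w s t) ≡ (v , spanChain s t ++ inv (cospanChain s t))
    confluenceCycle≡ {u} {v} {w} s t = cong (λ δ → v , spanChain s t ++ δ) (sym (begin
      inv (toChain α ++ inv (toChain β))
        ≡⟨ inv-++ (toChain α) (inv (toChain β)) ⟩
      inv (inv (toChain β)) ++ inv (toChain α)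
        ≡⟨ cong (_++ inv (toChain α)) (inv-involutive (toChain β)) ⟩
      toChain β ++ inv (toChain α)
        ∎))
      where
        open ≡-Reasoning
        α = proj₁ (proj₂ (L (span u v w s t)))
        β = proj₂ (proj₂ (L (span u v w s t)))

    All-verts-cospanChain : (s : R u v) (t : R u w) → All (_≺ u) (verts (cospanChain s t))
    All-verts-cospanChain {u} {v} {w} s t =
      subst (All (_≺ u)) (sym (verts-++ (toChain α) (inv (toChain β))))
        (All.++⁺ (All-verts-inv (toChain β) Plus.[ t ] (below Plus.[ t ] β)) (below Plus.[ s ] α))
      where
        α = proj₁ (proj₂ (L (span u v w s t)))
        β = proj₂ (proj₂ (L (span u v w s t)))
        below : ∀ {x y} → x ≺ u → (γ : Star R x y) → All (_≺ u) (verts (toChain γ))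
        below x≺u γ = subst (All (_≺ u)) (sym (verts-toChain γ)) (All-verts-≺ x≺u γ)

    -- Two multiset steps: drop w, which need not be a vertex of the cospan chain, then replace u
    -- by the vertices of the cospan chain, all of which lie below u.
    cospanChain-⋖⁺ : ∀ {M} (s : R u v) (t : R u w) (δ : Chain R w v) →
      verts (spanChain s t ++ δ) ↭ M → verts (cospanChain s t ++ δ) ⋖⁺ M
    cospanChain-⋖⁺ {u} {v} {w} s t δ ↭M = replace-u ∷ Plus.[ drop-w ]
      where
        drop-w : u ∷ verts δ ⋖ _
        drop-w = w , u ∷ verts δ , [] , ↭-trans (↭-sym ↭M) (verts-++-↭ (spanChain s t) δ)
               , ↭-refl , []
        replace-u : verts (cospanChain s t ++ δ) ⋖ u ∷ verts δ
        replace-u = u , verts δ , verts (cospanChain s t) , ↭-refl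
                  , verts-++-↭ (cospanChain s t) δ , All-verts-cospanChain s t

    module _ {Q : Cycle R → Set ℓ} (mergeQ : StableUnderMerging Q)
             (confluentQ : (κ : Span R) → Q (confluenceCycle L κ)) where

      merge-confluenceCycle : (s : R u v) (t : R u w) (δ : Chain R w v) →
                              Q (v , cospanChain s t ++ δ) → Q (v , spanChain s t ++ δ)
      merge-confluenceCycle {u} {v} {w} s t δ q =
        substᶜ Q (cong (spanChain s t ++_) (inv-involutive δ))
          (mergeQ (spanChain s t) (cospanChain s t) (inv δ)
             (subst Q (confluenceCycle≡ s t) (confluentQ (span u v w s t)))
             (substᶜ Q (cong (cospanChain s t ++_) (sym (inv-involutive δ))) q))

  cycle-induction : Noetherian R → (L : LocalConfluenceStructure R) → (Q : Cycle R → Set ℓ) →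
    StableUnderMerging Q → StableUnderRotating Q →
    ((γ : EmptyCycle {R = R}) → Q (proj₁ γ)) → ((κ : Span R) → Q (confluenceCycle L κ)) →
    (α : Cycle R) → Q α
  cycle-induction noeth L Q mergeQ rotQ emptyQ confluentQ α = go α (⊏-wellFounded noeth α)
    where
      open Confluence L
      go : (α : Cycle R) → Acc _⊏_ α → Q α
      go (a , γ) (acc rs) with cycleShape noeth γ
      ... | empty γ-empty = emptyQ ((a , γ) , γ-empty)
      ... | rotatedPeak α β s t δ refl β++α≡ =
        rotate-prefix rotQ α β (consView β)
          (substᶜ Q (sym β++α≡)
            (merge-confluenceCycle {Q = Q} mergeQ confluentQ s t δ (go _ (rs smaller))))
        where
          smaller : (_ , cospanChain s t ++ δ) ⊏ (a , α ++ β)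
          smaller = cospanChain-⋖⁺ s t δ
                      (↭-trans (↭-reflexive (cong verts (sym β++α≡))) (verts-rotate β α))

  emptyCycle≡ε : isSet A → (γ : EmptyCycle {R = R}) → proj₁ γ ≡ ε (proj₁ (proj₁ γ))
  emptyCycle≡ε isSetA ((a , γ) , γ-empty) with length≡0⇒nil γ γ-empty
  ... | p , p*nil≡γ = cong (a ,_) (begin
    γ                           ≡⟨ p*nil≡γ ⟨
    subst (Chain R a) p nil     ≡⟨ cong (λ q → subst (Chain R a) q nil) (isSetA a a p refl) ⟩
    nil                         ∎)
    where open ≡-Reasoning

theorem6p2 : ∀ {ℓ : Level} {A : Set ℓ} (R : A → A → Set ℓ)
    → Noetherian R
    → (L : LocalConfluenceStructure R)
    → (Q : Cycle R → Set ℓ)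
    → StableUnderMerging Q
    → StableUnderRotating Q
    → (((γ : EmptyCycle {R = R}) → Q (proj₁ γ))
         → ((κ : Span R) → Q (confluenceCycle L κ))
         → (α : Cycle R) → Q α)
      × (isSet A
         → ((a : A) → Q (ε {R = R} a))
         → ((κ : Span R) → Q (confluenceCycle L κ))
         → (α : Cycle R) → Q α)
theorem6p2 R noeth L Q mergeQ rotQ =
    cycle-induction noeth L Q mergeQ rotQ
  , λ isSetA εQ → cycle-induction noeth L Q mergeQ rotQ
                    (λ γ → subst Q (sym (emptyCycle≡ε isSetA γ)) (εQ _))
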